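{- Let $n\ge 2$ and let $t$ be a (non-plane) rooted binary tree with $n$ leaves. For an internal node $u$ of $t$ let $\lfloor t(u)\rfloor$ be the number of internal nodes in the subtree of $t$ rooted at $u$; let $s(t)$ be the number of symmetry nodes of $t$ (internal nodes whose two child subtrees are isomorphic as rooted trees); and let $\gimel(t)$ be the number of cherry nodes of $t$ (internal nodes both of whose children are leaves). Then the number of ranked (non-plane) trees with $n$ leaves whose underlying tree (obtained by forgetting the ranks) is $t$ equals \[ \frac{(n-1)!}{\prod_{u}\lfloor t(u)\rfloor}\;2^{\,\gimel(t)-s(t)}, \] the product running over all internal nodes $u$ of $t$.
   Context: All trees are finite rooted binary trees (every internal node has exactly two children; $n$ leaves means $n-1$ internal nodes), with unlabeled nodes. A ranked tree with $n$ leaves is such a tree together with an internal ranking: a bijection from its $n-1$ internal nodes to $\{1,\dots,n-1\}$ such that the root has rank $1$ and whenever an internal node $w$ lies on the path from the root to an internal node $v\ne w$, the rank of $w$ is less than that of $v$. Ranked trees are identified up to rank-preserving isomorphism of rooted trees (no left/right order is imposed); plain trees are identified up to isomorphism of rooted trees. -}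

module Defs where

open import Data.Nat using (ℕ; zero; suc; _+_; _*_; _<_; _∸_)
open import Data.List using (List; []; _∷_; _++_; map; upTo)
open import Data.List.Relation.Unary.All using (All)
open import Data.List.Relation.Binary.Permutation.Propositional using (_↭_)
open import Data.Product using (_×_)
open import Relation.Binary.PropositionalEquality using (_≡_)
open import Relation.Nullary using (¬_)

-- Plain rooted binary trees (a concrete representative; non-plane trees are
-- identified up to the isomorphism _≅_ below).
data Tree : Set where
  leaf : Tree
  node : Tree → Tree → Tree

leaves : Tree → ℕ
leaves leaf = 1
leaves (node l r) = leaves l + leaves r

internals : Tree → ℕ
internals leaf = 0
internals (node l r) = suc (internals l + internals r)

data _≅_ : Tree → Tree → Set where
  leaf≅  : leaf ≅ leaf
  same≅  : ∀ {a b c d} → a ≅ c → b ≅ d → node a b ≅ node c d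
  cross≅ : ∀ {a b c d} → a ≅ d → b ≅ c → node a b ≅ node c d

subtreeProd : Tree → ℕ
subtreeProd leaf = 1
subtreeProd (node l r) = internals (node l r) * (subtreeProd l * subtreeProd r)

cherries : Tree → ℕ
cherries leaf = 0
cherries (node leaf leaf) = 1
cherries (node l r) = cherries l + cherries r

data SymCount : Tree → ℕ → Set where
  symLeaf : SymCount leaf 0
  symYes  : ∀ {l r i j} → l ≅ r → SymCount l i → SymCount r j →
            SymCount (node l r) (suc (i + j))
  symNo   : ∀ {l r i j} → ¬ (l ≅ r) → SymCount l i → SymCount r j →
            SymCount (node l r) (i + j)

-- Trees whose internal nodes carry a natural-number label (the rank)
data RTree : Set where
  rleaf : RTree
  rnode : ℕ → RTree → RTree → RTree

forget : RTree → Tree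
forget rleaf = leaf
forget (rnode _ l r) = node (forget l) (forget r)

ranks : RTree → List ℕ
ranks rleaf = []
ranks (rnode k l r) = k ∷ (ranks l ++ ranks r)

data Increasing : RTree → Set where
  incLeaf : Increasing rleaf
  incNode : ∀ {k l r} → All (k <_) (ranks l) → All (k <_) (ranks r) →
            Increasing l → Increasing r → Increasing (rnode k l r)

-- r is a ranked tree with n leaves: the internal nodes are labelled
-- bijectively by 1..n-1 and ranks increase along root-to-node paths
-- (root rank 1 is then forced).
IsRanking : ℕ → RTree → Set
IsRanking n r = leaves (forget r) ≡ n × (ranks r ↭ map suc (upTo (n ∸ 1))) × Increasing r

data _≅ʳ_ : RTree → RTree → Set where
  leaf≅ʳ  : rleaf ≅ʳ rleaf
  same≅ʳ  : ∀ {k a b c d} → a ≅ʳ c → b ≅ʳ d → rnode k a b ≅ʳ rnode k c d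
  cross≅ʳ : ∀ {k a b c d} → a ≅ʳ d → b ≅ʳ c → rnode k a b ≅ʳ rnode k c d

module Submission where

-- For a shape t and a sorted list S of internals t distinct ranks we build an explicit
-- list  rankings t S  of ranked trees of shape t.  The root receives the least rank of S;
-- the remaining ranks are distributed between the two subtrees in every order-preserving
-- way (the "splits" of a list, counted by the shuffle numbers  (a + b choose a)).  At a
-- symmetry node (l ≅ r) exchanging the subtrees would list every ranked tree twice, so
-- there only the splits sending the least remaining rank to the left are used.
--
-- Its length obeys the recurrence
--   count (node l r) = (number of admissible splits) * count l * count r,
-- and unfolding this against  (a + b + 1)! = (a + b + 1) * (a + b choose a) * a! * b!,
-- with the halving at non-cherry symmetry nodes, yields the formula of the theorem.

open import Defs
open import Data.Nat using (ℕ; zero; suc; _+_; _*_; _^_; _≤_; _<_; _∸_; _!; s≤s)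
open import Data.Nat.Properties
  using (+-comm; +-suc; +-identityʳ; *-identityˡ; *-identityʳ; suc-injective; <-irrefl; <-asym; ^-distribˡ-+-*)
open import Data.Nat.Tactic.RingSolver using (solve-∀)
open import Data.Product using (Σ; Σ-syntax; _×_; _,_; proj₁; proj₂; swap)
open import Data.Sum using (_⊎_; inj₁; inj₂)
open import Data.Empty using (⊥-elim)
open import Relation.Nullary using (¬_; Dec; yes; no)
open import Relation.Binary.PropositionalEquality
  using (_≡_; _≢_; refl; sym; trans; cong; cong₂; subst; subst₂; module ≡-Reasoning)
open import Data.List using (List; []; _∷_; _++_; [_]; map; length; upTo; concatMap; cartesianProductWith)
open import Data.List.Properties using (length-++; length-map; length-upTo)
open import Data.List.Relation.Unary.All as All using (All; []; _∷_)
import Data.List.Relation.Unary.All.Properties as All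
open import Data.List.Relation.Unary.Any using (Any; here; there)
open import Data.List.Relation.Unary.AllPairs using (AllPairs; []; _∷_)
import Data.List.Relation.Unary.AllPairs.Properties as AllPairs
open import Data.List.Relation.Unary.Unique.Propositional using (Unique)
import Data.List.Relation.Unary.Unique.Propositional.Properties as Unique
open import Data.List.Relation.Binary.Disjoint.Propositional using (Disjoint)
open import Data.List.Membership.Propositional using (_∈_; _∉_; find; lose)
open import Data.List.Membership.Propositional.Properties
  using (∈-++⁻; ∈-++⁺ˡ; ∈-++⁺ʳ; ∈-map⁺; ∈-map⁻; ∈-∃++; ∈-concatMap⁺; ∈-concatMap⁻;
         ∈-cartesianProductWith⁺; ∈-cartesianProductWith⁻)
open import Data.List.Relation.Binary.Subset.Propositional using (_⊆_)
open import Data.List.Relation.Binary.Subset.Propositional.Properties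
  using (⊆-trans; ⊆-reflexive-↭; All-resp-⊇; xs⊆xs++ys; xs⊆ys++xs; ⊆∷∧∉⇒⊆)
open import Data.List.Relation.Binary.Permutation.Propositional
  using (_↭_; ↭-refl; ↭-sym; ↭-trans; prep)
open import Data.List.Relation.Binary.Permutation.Propositional.Properties
  using (∈-resp-↭; All-resp-↭; ↭-empty-inv; ↭-length; shift; drop-∷; ++⁺; ++-comm)

AllPairs-mapWith∈ : ∀ {A : Set} {R R′ : A → A → Set} {xs : List A} →
  (∀ {x y} → x ∈ xs → y ∈ xs → R x y → R′ x y) → AllPairs R xs → AllPairs R′ xs
AllPairs-mapWith∈ f [] = []
AllPairs-mapWith∈ f (Rx ∷ Rxs) =
  All.tabulate (λ y∈ → f (here refl) (there y∈) (All.lookup Rx y∈))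
  ∷ AllPairs-mapWith∈ (λ x∈ y∈ → f (there x∈) (there y∈)) Rxs

length-concatMap : ∀ {A B : Set} (f : A → List B) {c} {xs : List A} →
  All (λ x → length (f x) ≡ c) xs → length (concatMap f xs) ≡ length xs * c
length-concatMap f [] = refl
length-concatMap f {xs = x ∷ _} (e ∷ es) = trans (length-++ (f x)) (cong₂ _+_ e (length-concatMap f es))

length-cartesianProductWith : ∀ {A B C : Set} (f : A → B → C) xs ys →
  length (cartesianProductWith f xs ys) ≡ length xs * length ys
length-cartesianProductWith f []       ys = refl
length-cartesianProductWith f (x ∷ xs) ys =
  trans (length-++ (map (f x) ys)) (cong₂ _+_ (length-map (f x) ys) (length-cartesianProductWith f xs ys))

remove : ∀ {h : ℕ} {zs} → h ∈ zs → Σ[ zs′ ∈ List ℕ ] zs ↭ h ∷ zs′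
remove h∈ with ∈-∃++ h∈
... | us , vs , refl = us ++ vs , shift _ us vs

Sorted : List ℕ → Set
Sorted = AllPairs _<_

head∉tail : ∀ {h T} → All (h <_) T → h ∉ T
head∉tail h<T h∈T = <-irrefl refl (All.lookup h<T h∈T)

-- Shuffle numbers: shuffles a b = (a + b choose a)

shuffles : ℕ → ℕ → ℕ
shuffles zero    b       = 1
shuffles (suc a) zero    = 1
shuffles (suc a) (suc b) = shuffles a (suc b) + shuffles (suc a) b

shuffles-zeroʳ : ∀ a → shuffles a 0 ≡ 1
shuffles-zeroʳ zero    = refl
shuffles-zeroʳ (suc a) = refl

shuffles-comm : ∀ a b → shuffles a b ≡ shuffles b a
shuffles-comm zero    zero    = refl
shuffles-comm zero    (suc b) = refl
shuffles-comm (suc a) zero    = refl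
shuffles-comm (suc a) (suc b) =
  trans (cong₂ _+_ (shuffles-comm a (suc b)) (shuffles-comm (suc a) b)) (+-comm (shuffles (suc b) a) _)

-- On the diagonal, exchanging the roles of the two lists pairs the shuffles up.
shuffles-diagonal : ∀ a → shuffles (suc a) (suc a) ≡ 2 * shuffles a (suc a)
shuffles-diagonal a = cong (shuffles a (suc a) +_)
  (trans (shuffles-comm (suc a) a) (sym (+-identityʳ (shuffles a (suc a)))))

shuffles-factorial : ∀ a b → shuffles a b * (a ! * b !) ≡ (a + b) !
shuffles-factorial zero b = trans (*-identityˡ _) (*-identityˡ _)
shuffles-factorial (suc a) zero rewrite +-identityʳ a = trans (*-identityˡ _) (*-identityʳ _)
shuffles-factorial (suc a) (suc b) = begin
    (X + Y) * (suc a ! * suc b !)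
  ≡⟨ distribute X Y a b (a !) (b !) ⟩
    suc a * (X * (a ! * suc b !)) + suc b * (Y * (suc a ! * b !))
  ≡⟨ cong₂ (λ u v → suc a * u + suc b * v) (shuffles-factorial a (suc b)) (shuffles-factorial (suc a) b) ⟩
    suc a * (a + suc b) ! + suc b * (suc a + b) !
  ≡⟨ cong (λ m → suc a * (a + suc b) ! + suc b * m !) (sym (+-suc a b)) ⟩
    suc a * (a + suc b) ! + suc b * (a + suc b) !
  ≡⟨ collect a b ((a + suc b) !) ⟩
    (suc a + suc b) !
  ∎
  where
  open ≡-Reasoning
  X Y : ℕ
  X = shuffles a (suc b)
  Y = shuffles (suc a) b
  distribute : ∀ X Y a b fa fb → (X + Y) * ((suc a * fa) * (suc b * fb))
             ≡ suc a * (X * (fa * (suc b * fb))) + suc b * (Y * ((suc a * fa) * fb))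
  distribute = solve-∀
  collect : ∀ a b F → suc a * F + suc b * F ≡ suc (a + suc b) * F
  collect = solve-∀

-- Splits of a list: all ways of distributing its elements, keeping their order,
-- into a left part of length a and a right part of length b.

Split : Set
Split = List ℕ × List ℕ

addLeft addRight : ℕ → Split → Split
addLeft  h (A , B) = h ∷ A , B
addRight h (A , B) = A , h ∷ B

splits : List ℕ → ℕ → ℕ → List Split
headLeft headRight : ℕ → List ℕ → ℕ → ℕ → List Split

splits []      zero    zero    = [ ([] , []) ]
splits []      zero    (suc b) = []
splits []      (suc a) b       = []
splits (h ∷ T) a       b       = headLeft h T a b ++ headRight h T a b

headLeft h T zero    b = []
headLeft h T (suc a) b = map (addLeft h) (splits T a b)

headRight h T a zero    = []
headRight h T a (suc b) = map (addRight h) (splits T a b)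

data SplitView : List ℕ → ℕ → ℕ → Split → Set where
  viaNil   : SplitView [] 0 0 ([] , [])
  viaLeft  : ∀ {h T a b q} → q ∈ splits T a b → SplitView (h ∷ T) (suc a) b (addLeft h q)
  viaRight : ∀ {h T a b q} → q ∈ splits T a b → SplitView (h ∷ T) a (suc b) (addRight h q)

headLeft⁻ : ∀ h T a b {p} → p ∈ headLeft h T a b → SplitView (h ∷ T) a b p
headLeft⁻ h T (suc a) b p∈ with ∈-map⁻ (addLeft h) p∈
... | q , q∈ , refl = viaLeft q∈

headRight⁻ : ∀ h T a b {p} → p ∈ headRight h T a b → SplitView (h ∷ T) a b p
headRight⁻ h T a (suc b) p∈ with ∈-map⁻ (addRight h) p∈
... | q , q∈ , refl = viaRight q∈

splitView : ∀ S a b {p} → p ∈ splits S a b → SplitView S a b p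
splitView []      zero zero (here refl) = viaNil
splitView (h ∷ T) a    b    p∈ with ∈-++⁻ (headLeft h T a b) p∈
... | inj₁ p∈L = headLeft⁻ h T a b p∈L
... | inj₂ p∈R = headRight⁻ h T a b p∈R

viaLeft⁺ : ∀ h T a b {q} → q ∈ splits T a b → addLeft h q ∈ splits (h ∷ T) (suc a) b
viaLeft⁺ h T a b q∈ = ∈-++⁺ˡ (∈-map⁺ (addLeft h) q∈)

viaRight⁺ : ∀ h T a b {q} → q ∈ splits T a b → addRight h q ∈ splits (h ∷ T) a (suc b)
viaRight⁺ h T a b q∈ = ∈-++⁺ʳ (headLeft h T a (suc b)) (∈-map⁺ (addRight h) q∈)

splits-↭ : ∀ S {a b p} → p ∈ splits S a b → proj₁ p ++ proj₂ p ↭ S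
splits-↭ [] {a} {b} p∈ with splitView [] a b p∈
... | viaNil = ↭-refl
splits-↭ (h ∷ T) {a} {b} p∈ with splitView (h ∷ T) a b p∈
... | viaLeft q∈                = prep h (splits-↭ T q∈)
... | viaRight {q = A , B} q∈ = ↭-trans (shift h A B) (prep h (splits-↭ T q∈))

splits-⊆ˡ : ∀ S {a b p} → p ∈ splits S a b → proj₁ p ⊆ S
splits-⊆ˡ S {p = A , B} p∈ = ⊆-trans (xs⊆xs++ys A B) (⊆-reflexive-↭ (splits-↭ S p∈))

splits-⊆ʳ : ∀ S {a b p} → p ∈ splits S a b → proj₂ p ⊆ S
splits-⊆ʳ S {p = A , B} p∈ = ⊆-trans (xs⊆ys++xs B A) (⊆-reflexive-↭ (splits-↭ S p∈))

splits-length : ∀ S {a b p} → p ∈ splits S a b → length (proj₁ p) ≡ a × length (proj₂ p) ≡ b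
splits-length [] {a} {b} p∈ with splitView [] a b p∈
... | viaNil = refl , refl
splits-length (h ∷ T) {a} {b} p∈ with splitView (h ∷ T) a b p∈
... | viaLeft q∈  = let eA , eB = splits-length T q∈ in cong suc eA , eB
... | viaRight q∈ = let eA , eB = splits-length T q∈ in eA , cong suc eB

splits-sorted : ∀ S {a b p} → Sorted S → p ∈ splits S a b → Sorted (proj₁ p) × Sorted (proj₂ p)
splits-sorted [] {a} {b} _ p∈ with splitView [] a b p∈
... | viaNil = [] , []
splits-sorted (h ∷ T) {a} {b} (h<T ∷ sT) p∈ with splitView (h ∷ T) a b p∈
... | viaLeft q∈  = let sA , sB = splits-sorted T sT q∈ in All-resp-⊇ (splits-⊆ˡ T q∈) h<T ∷ sA , sB
... | viaRight q∈ = let sA , sB = splits-sorted T sT q∈ in sA , All-resp-⊇ (splits-⊆ʳ T q∈) h<T ∷ sB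

splits-disjoint : ∀ S {a b p} → Sorted S → p ∈ splits S a b → Disjoint (proj₁ p) (proj₂ p)
splits-disjoint [] {a} {b} _ p∈ with splitView [] a b p∈
... | viaNil = λ { (() , _) }
splits-disjoint (h ∷ T) {a} {b} (h<T ∷ sT) p∈ with splitView (h ∷ T) a b p∈
... | viaLeft q∈ = λ
  { (here refl , z∈B) → head∉tail h<T (splits-⊆ʳ T q∈ z∈B)
  ; (there z∈A , z∈B) → splits-disjoint T sT q∈ (z∈A , z∈B) }
... | viaRight q∈ = λ
  { (z∈A , here refl) → head∉tail h<T (splits-⊆ˡ T q∈ z∈A)
  ; (z∈A , there z∈B) → splits-disjoint T sT q∈ (z∈A , z∈B) }

splits-swap : ∀ S {a b p} → p ∈ splits S a b → swap p ∈ splits S b a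
splits-swap [] {a} {b} p∈ with splitView [] a b p∈
... | viaNil = here refl
splits-swap (h ∷ T) {a} {b} p∈ with splitView (h ∷ T) a b p∈
... | viaLeft {a = a′} q∈  = viaRight⁺ h T b a′ (splits-swap T q∈)
... | viaRight {b = b′} q∈ = viaLeft⁺ h T b′ a (splits-swap T q∈)

splits-[] : ∀ a b {p} → p ∈ splits [] a b → p ≡ ([] , [])
splits-[] zero zero (here refl) = refl

splits-complete : ∀ S xs ys → xs ++ ys ↭ S →
  Σ[ p ∈ Split ] p ∈ splits S (length xs) (length ys) × xs ↭ proj₁ p × ys ↭ proj₂ p
splits-complete [] [] [] _ = ([] , []) , here refl , ↭-refl , ↭-refl
splits-complete [] (x ∷ xs) ys xs++ys↭[] with ↭-empty-inv xs++ys↭[]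
... | ()
splits-complete [] [] (y ∷ ys) ys↭[] with ↭-empty-inv ys↭[]
... | ()
splits-complete (h ∷ T) xs ys xs++ys↭S with ∈-++⁻ xs (∈-resp-↭ (↭-sym xs++ys↭S) (here refl))
... | inj₁ h∈xs =
  let xs′ , xs↭ = remove h∈xs
      q , q∈ , xs′↭ , ys↭ = splits-complete T xs′ ys
                              (drop-∷ (↭-trans (↭-sym (++⁺ xs↭ (↭-refl {x = ys}))) xs++ys↭S))
  in addLeft h q
     , subst (λ a → addLeft h q ∈ splits (h ∷ T) a (length ys)) (sym (↭-length xs↭)) (viaLeft⁺ h T _ _ q∈)
     , ↭-trans xs↭ (prep h xs′↭) , ys↭
... | inj₂ h∈ys =
  let ys′ , ys↭ = remove h∈ys
      q , q∈ , xs↭ , ys′↭ = splits-complete T xs ys′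
                              (drop-∷ (↭-trans (↭-sym (↭-trans (++⁺ (↭-refl {x = xs}) ys↭) (shift h xs ys′)))
                                               xs++ys↭S))
  in addRight h q
     , subst (λ b → addRight h q ∈ splits (h ∷ T) (length xs) b) (sym (↭-length ys↭)) (viaRight⁺ h T _ _ q∈)
     , xs↭ , ↭-trans ys↭ (prep h ys′↭)

splits-determined : ∀ S {a b c d p q} → Sorted S → p ∈ splits S a b → q ∈ splits S c d →
  proj₁ p ⊆ proj₁ q → proj₂ p ⊆ proj₂ q → p ≡ q
splits-determined [] {a} {b} {c} {d} _ p∈ q∈ _ _ with splitView [] a b p∈ | splitView [] c d q∈
... | viaNil | viaNil = refl
splits-determined (h ∷ T) {a} {b} {c} {d} (h<T ∷ sT) p∈ q∈ A⊆ B⊆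
  with splitView (h ∷ T) a b p∈ | splitView (h ∷ T) c d q∈
... | viaLeft p′∈ | viaLeft q′∈ = cong (addLeft h)
  (splits-determined T sT p′∈ q′∈ (⊆∷∧∉⇒⊆ (λ z∈ → A⊆ (there z∈)) (λ h∈ → head∉tail h<T (splits-⊆ˡ T p′∈ h∈))) B⊆)
... | viaLeft _    | viaRight q′∈ = ⊥-elim (head∉tail h<T (splits-⊆ˡ T q′∈ (A⊆ (here refl))))
... | viaRight _   | viaLeft q′∈  = ⊥-elim (head∉tail h<T (splits-⊆ʳ T q′∈ (B⊆ (here refl))))
... | viaRight p′∈ | viaRight q′∈ = cong (addRight h)
  (splits-determined T sT p′∈ q′∈ A⊆ (⊆∷∧∉⇒⊆ (λ z∈ → B⊆ (there z∈)) (λ h∈ → head∉tail h<T (splits-⊆ʳ T p′∈ h∈))))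

addLeft-injective : ∀ {h p q} → addLeft h p ≡ addLeft h q → p ≡ q
addLeft-injective refl = refl

addRight-injective : ∀ {h p q} → addRight h p ≡ addRight h q → p ≡ q
addRight-injective refl = refl

headLeft-head : ∀ h T a b {p} → p ∈ headLeft h T a b → h ∈ proj₁ p
headLeft-head h T (suc a) b p∈ with ∈-map⁻ (addLeft h) p∈
... | _ , _ , refl = here refl

headRight-⊆ : ∀ h T a b {p} → p ∈ headRight h T a b → proj₁ p ⊆ T
headRight-⊆ h T a (suc b) p∈ with ∈-map⁻ (addRight h) p∈
... | _ , q∈ , refl = splits-⊆ˡ T q∈

splits-unique : ∀ S a b → Sorted S → Unique (splits S a b)
headLeft-unique : ∀ h T a b → Sorted T → Unique (headLeft h T a b)
headRight-unique : ∀ h T a b → Sorted T → Unique (headRight h T a b)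

splits-unique []      zero    zero    _ = [] ∷ []
splits-unique []      zero    (suc b) _ = []
splits-unique []      (suc a) b       _ = []
splits-unique (h ∷ T) a       b       (h<T ∷ sT) =
  Unique.++⁺ (headLeft-unique h T a b sT) (headRight-unique h T a b sT)
    (λ (p∈L , p∈R) → head∉tail h<T (headRight-⊆ h T a b p∈R (headLeft-head h T a b p∈L)))

headLeft-unique h T zero    b _  = []
headLeft-unique h T (suc a) b sT = Unique.map⁺ addLeft-injective (splits-unique T a b sT)

headRight-unique h T a zero    _  = []
headRight-unique h T a (suc b) sT = Unique.map⁺ addRight-injective (splits-unique T a b sT)

length-splits : ∀ S a b → length S ≡ a + b → length (splits S a b) ≡ shuffles a b

length-headLeft : ∀ h T a b → length T ≡ a + b → length (headLeft h T (suc a) b) ≡ shuffles a b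
length-headLeft h T a b e = trans (length-map (addLeft h) (splits T a b)) (length-splits T a b e)

length-headRight : ∀ h T a b → length T ≡ a + b → length (headRight h T a (suc b)) ≡ shuffles a b
length-headRight h T a b e = trans (length-map (addRight h) (splits T a b)) (length-splits T a b e)

length-splits []      zero    zero    _ = refl
length-splits (h ∷ T) zero    (suc b) e = length-headRight h T 0 b (suc-injective e)
length-splits (h ∷ T) (suc a) zero    e =
  trans (length-++ (headLeft h T (suc a) 0))
        (trans (+-identityʳ _) (trans (length-headLeft h T a 0 (suc-injective e)) (shuffles-zeroʳ a)))
length-splits (h ∷ T) (suc a) (suc b) e = trans (length-++ (headLeft h T (suc a) (suc b)))
  (cong₂ _+_ (length-headLeft h T a (suc b) (suc-injective e))
             (length-headRight h T (suc a) b (trans (suc-injective e) (+-suc a b))))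

-- Left-first splits: those sending the least element of the list to the left part.
-- At a symmetry node they pick one split out of each pair {p , swap p}.

leftFirst : List ℕ → ℕ → ℕ → List Split
leftFirst []      = splits []
leftFirst (h ∷ T) = headLeft h T

-- the number of left-first splits: those of the elements other than the least one
leftFirstCount : ℕ → ℕ → ℕ
leftFirstCount zero    zero    = 1
leftFirstCount zero    (suc b) = 0
leftFirstCount (suc a) b       = shuffles a b

leftFirst-⊆ : ∀ S a b {p} → p ∈ leftFirst S a b → p ∈ splits S a b
leftFirst-⊆ []      a b p∈ = p∈
leftFirst-⊆ (h ∷ T) a b p∈ = ∈-++⁺ˡ p∈

leftFirst-cover : ∀ S a b {p} → p ∈ splits S a b → p ∈ leftFirst S a b ⊎ swap p ∈ leftFirst S b a
leftFirst-cover [] a b p∈ = inj₁ p∈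
leftFirst-cover (h ∷ T) a b p∈ with splitView (h ∷ T) a b p∈
... | viaLeft q∈  = inj₁ (∈-map⁺ (addLeft h) q∈)
... | viaRight q∈ = inj₂ (∈-map⁺ (addLeft h) (splits-swap T q∈))

leftFirst-unique : ∀ S a b → Sorted S → Unique (leftFirst S a b)
leftFirst-unique []      a b sS         = splits-unique [] a b sS
leftFirst-unique (h ∷ T) a b (_ ∷ sT) = headLeft-unique h T a b sT

length-leftFirst : ∀ S a b → length S ≡ a + b → length (leftFirst S a b) ≡ leftFirstCount a b
length-leftFirst []      zero    zero    _ = refl
length-leftFirst (h ∷ T) zero    (suc b) _ = refl
length-leftFirst (h ∷ T) (suc a) b       e = length-headLeft h T a b (suc-injective e)

≅-refl : ∀ t → t ≅ t
≅-refl leaf       = leaf≅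
≅-refl (node a b) = same≅ (≅-refl a) (≅-refl b)

≅-sym : ∀ {s t} → s ≅ t → t ≅ s
≅-sym leaf≅        = leaf≅
≅-sym (same≅ p q)  = same≅ (≅-sym p) (≅-sym q)
≅-sym (cross≅ p q) = cross≅ (≅-sym q) (≅-sym p)

≅-trans : ∀ {s t u} → s ≅ t → t ≅ u → s ≅ u
≅-trans leaf≅        q             = q
≅-trans (same≅ p q)  (same≅ p′ q′)  = same≅ (≅-trans p p′) (≅-trans q q′)
≅-trans (same≅ p q)  (cross≅ p′ q′) = cross≅ (≅-trans p p′) (≅-trans q q′)
≅-trans (cross≅ p q) (same≅ p′ q′)  = cross≅ (≅-trans p q′) (≅-trans q p′)
≅-trans (cross≅ p q) (cross≅ p′ q′) = same≅ (≅-trans p q′) (≅-trans q p′)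

_≅?_ : ∀ s t → Dec (s ≅ t)
leaf     ≅? leaf     = yes leaf≅
leaf     ≅? node _ _ = no λ ()
node _ _ ≅? leaf     = no λ ()
node a b ≅? node c d with a ≅? c | b ≅? d | a ≅? d | b ≅? c
... | yes a≅c | yes b≅d | _       | _       = yes (same≅ a≅c b≅d)
... | _       | _       | yes a≅d | yes b≅c = yes (cross≅ a≅d b≅c)
... | no a≇c  | _       | no a≇d  | _       = no λ { (same≅ a≅c _) → a≇c a≅c ; (cross≅ a≅d _) → a≇d a≅d }
... | no a≇c  | _       | yes _   | no b≇c  = no λ { (same≅ a≅c _) → a≇c a≅c ; (cross≅ _ b≅c) → b≇c b≅c }
... | yes _   | no b≇d  | no a≇d  | _       = no λ { (same≅ _ b≅d) → b≇d b≅d ; (cross≅ a≅d _) → a≇d a≅d }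
... | yes _   | no b≇d  | yes _   | no b≇c  = no λ { (same≅ _ b≅d) → b≇d b≅d ; (cross≅ _ b≅c) → b≇c b≅c }

internals-≅ : ∀ {s t} → s ≅ t → internals s ≡ internals t
internals-≅ leaf≅ = refl
internals-≅ (same≅ p q) = cong suc (cong₂ _+_ (internals-≅ p) (internals-≅ q))
internals-≅ (cross≅ {c = c} {d} p q) =
  cong suc (trans (cong₂ _+_ (internals-≅ p) (internals-≅ q)) (+-comm (internals d) (internals c)))

cherries-node : ∀ l r → ¬ l ≅ r → cherries (node l r) ≡ cherries l + cherries r
cherries-node leaf       leaf       l≇r = ⊥-elim (l≇r leaf≅)
cherries-node leaf       (node _ _) _   = refl
cherries-node (node _ _) r          _   = refl

leaves-internals : ∀ t → leaves t ≡ suc (internals t)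
leaves-internals leaf       = refl
leaves-internals (node l r) =
  trans (cong₂ _+_ (leaves-internals l) (leaves-internals r)) (cong suc (+-suc (internals l) (internals r)))

≅ʳ-refl : ∀ u → u ≅ʳ u
≅ʳ-refl rleaf         = leaf≅ʳ
≅ʳ-refl (rnode k a b) = same≅ʳ (≅ʳ-refl a) (≅ʳ-refl b)

≅ʳ-trans : ∀ {s t u} → s ≅ʳ t → t ≅ʳ u → s ≅ʳ u
≅ʳ-trans leaf≅ʳ        q              = q
≅ʳ-trans (same≅ʳ p q)  (same≅ʳ p′ q′)  = same≅ʳ (≅ʳ-trans p p′) (≅ʳ-trans q q′)
≅ʳ-trans (same≅ʳ p q)  (cross≅ʳ p′ q′) = cross≅ʳ (≅ʳ-trans p p′) (≅ʳ-trans q q′)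
≅ʳ-trans (cross≅ʳ p q) (same≅ʳ p′ q′)  = cross≅ʳ (≅ʳ-trans p q′) (≅ʳ-trans q p′)
≅ʳ-trans (cross≅ʳ p q) (cross≅ʳ p′ q′) = same≅ʳ (≅ʳ-trans p q′) (≅ʳ-trans q p′)

ranks-≅ʳ : ∀ {u v} → u ≅ʳ v → ranks u ↭ ranks v
ranks-≅ʳ leaf≅ʳ = ↭-refl
ranks-≅ʳ (same≅ʳ {k} p q) = prep k (++⁺ (ranks-≅ʳ p) (ranks-≅ʳ q))
ranks-≅ʳ (cross≅ʳ {k} {c = c} {d} p q) = prep k (↭-trans (++⁺ (ranks-≅ʳ p) (ranks-≅ʳ q)) (++-comm (ranks d) (ranks c)))

forget-≅ʳ : ∀ {u v} → u ≅ʳ v → forget u ≅ forget v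
forget-≅ʳ leaf≅ʳ        = leaf≅
forget-≅ʳ (same≅ʳ p q)  = same≅ (forget-≅ʳ p) (forget-≅ʳ q)
forget-≅ʳ (cross≅ʳ p q) = cross≅ (forget-≅ʳ p) (forget-≅ʳ q)

length-ranks : ∀ u → length (ranks u) ≡ internals (forget u)
length-ranks rleaf         = refl
length-ranks (rnode k a b) = cong suc (trans (length-++ (ranks a)) (cong₂ _+_ (length-ranks a) (length-ranks b)))

root-least : ∀ {k s R S} → All (k <_) R → All (s <_) S → k ∷ R ↭ s ∷ S → k ≡ s
root-least k<R s<S kR↭sS with ∈-resp-↭ (↭-sym kR↭sS) (here refl)
... | here s≡k = sym s≡k
... | there s∈R with ∈-resp-↭ kR↭sS (here refl)
...   | here k≡s = k≡s
...   | there k∈S = ⊥-elim (<-asym (All.lookup k<R s∈R) (All.lookup s<S k∈S))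

graft : ℕ → (List ℕ → List RTree) → (List ℕ → List RTree) → List Split → List RTree
graft k el er = concatMap (λ p → cartesianProductWith (rnode k) (el (proj₁ p)) (er (proj₂ p)))

data Grafted (k : ℕ) (el er : List ℕ → List RTree) (sp : List Split) : RTree → Set where
  grafted : ∀ {p x y} → p ∈ sp → x ∈ el (proj₁ p) → y ∈ er (proj₂ p) → Grafted k el er sp (rnode k x y)

graft⁻ : ∀ k el er sp {u} → u ∈ graft k el er sp → Grafted k el er sp u
graft⁻ k el er sp u∈ with find (∈-concatMap⁻ _ {xs = sp} u∈)
... | p , p∈ , u∈p with ∈-cartesianProductWith⁻ (rnode k) (el (proj₁ p)) (er (proj₂ p)) u∈p
... | x , y , x∈ , y∈ , refl = grafted p∈ x∈ y∈

graft⁺ : ∀ k el er sp {p x y} → p ∈ sp → x ∈ el (proj₁ p) → y ∈ er (proj₂ p) → rnode k x y ∈ graft k el er sp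
graft⁺ k el er sp p∈ x∈ y∈ = ∈-concatMap⁺ _ {xs = sp} (lose p∈ (∈-cartesianProductWith⁺ (rnode k) x∈ y∈))

length-graft : ∀ k el er sp {c d} → All (λ p → length (el (proj₁ p)) ≡ c × length (er (proj₂ p)) ≡ d) sp →
  length (graft k el er sp) ≡ length sp * (c * d)
length-graft k el er sp {c} {d} lengths = length-concatMap _ (All.map product lengths)
  where
  product : ∀ {p} → length (el (proj₁ p)) ≡ c × length (er (proj₂ p)) ≡ d →
    length (cartesianProductWith (rnode k) (el (proj₁ p)) (er (proj₂ p))) ≡ c * d
  product {p} (eA , eB) = trans (length-cartesianProductWith (rnode k) (el (proj₁ p)) (er (proj₂ p))) (cong₂ _*_ eA eB)

rnode-injective : ∀ {k w x y z} → rnode k w y ≡ rnode k x z → w ≡ x × y ≡ z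
rnode-injective refl = refl , refl

graft-unique : ∀ k el er sp → Unique sp →
  (∀ {p} → p ∈ sp → Unique (el (proj₁ p)) × Unique (er (proj₂ p))) →
  (∀ {p q x y} → p ∈ sp → q ∈ sp → x ∈ el (proj₁ p) → x ∈ el (proj₁ q) →
                 y ∈ er (proj₂ p) → y ∈ er (proj₂ q) → p ≡ q) →
  Unique (graft k el er sp)
graft-unique k el er sp sp-unique children-unique determined =
  Unique.concat⁺ (All.map⁺ (All.tabulate products-unique))
                 (AllPairs.map⁺ (AllPairs-mapWith∈ separate sp-unique))
  where
  products-unique : ∀ {p} → p ∈ sp → Unique (cartesianProductWith (rnode k) (el (proj₁ p)) (er (proj₂ p)))
  products-unique p∈ = Unique.cartesianProductWith⁺ (rnode k) rnode-injective
                         (proj₁ (children-unique p∈)) (proj₂ (children-unique p∈))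
  separate : ∀ {p q} → p ∈ sp → q ∈ sp → p ≢ q →
    Disjoint (cartesianProductWith (rnode k) (el (proj₁ p)) (er (proj₂ p)))
             (cartesianProductWith (rnode k) (el (proj₁ q)) (er (proj₂ q)))
  separate {p} {q} p∈ q∈ p≢q (u∈p , u∈q)
    with ∈-cartesianProductWith⁻ (rnode k) (el (proj₁ p)) _ u∈p | ∈-cartesianProductWith⁻ (rnode k) (el (proj₁ q)) _ u∈q
  ... | x , y , x∈ , y∈ , refl | _ , _ , x∈′ , y∈′ , refl = p≢q (determined p∈ q∈ x∈ x∈′ y∈ y∈′)

splitsFor : ∀ {l r : Tree} → Dec (l ≅ r) → List ℕ → ℕ → ℕ → List Split
splitsFor (yes _) = leftFirst
splitsFor (no _)  = splits

splitCount : ∀ {l r : Tree} → Dec (l ≅ r) → ℕ → ℕ → ℕ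
splitCount (yes _) = leftFirstCount
splitCount (no _)  = shuffles

splitsFor-⊆ : ∀ {l r} (d : Dec (l ≅ r)) S a b {p} → p ∈ splitsFor d S a b → p ∈ splits S a b
splitsFor-⊆ (yes _) S a b p∈ = leftFirst-⊆ S a b p∈
splitsFor-⊆ (no _)  S a b p∈ = p∈

splitsFor-unique : ∀ {l r} (d : Dec (l ≅ r)) S a b → Sorted S → Unique (splitsFor d S a b)
splitsFor-unique (yes _) = leftFirst-unique
splitsFor-unique (no _)  = splits-unique

length-splitsFor : ∀ {l r} (d : Dec (l ≅ r)) S a b → length S ≡ a + b → length (splitsFor d S a b) ≡ splitCount d a b
length-splitsFor (yes _) = length-leftFirst
length-splitsFor (no _)  = length-splits

rankings : Tree → List ℕ → List RTree
rankings leaf       []      = [ rleaf ]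
rankings leaf       (_ ∷ _) = []
rankings (node l r) []      = []
rankings (node l r) (k ∷ S) = graft k (rankings l) (rankings r) (splitsFor (l ≅? r) S (internals l) (internals r))

rankings-[] : ∀ t {u} → u ∈ rankings t [] → u ≡ rleaf
rankings-[] leaf (here refl) = refl

record RankingOf (t : Tree) (S : List ℕ) (u : RTree) : Set where
  field
    shape      : forget u ≡ t
    rankList   : ranks u ↭ S
    increasing : Increasing u
open RankingOf

parts-sorted : ∀ {l r} (d : Dec (l ≅ r)) S → Sorted S → ∀ {p} →
  p ∈ splitsFor d S (internals l) (internals r) → Sorted (proj₁ p) × Sorted (proj₂ p)
parts-sorted {l} {r} d S sS p∈ = splits-sorted S sS (splitsFor-⊆ d S (internals l) (internals r) p∈)

rankings-sound : ∀ t S → Sorted S → ∀ {u} → u ∈ rankings t S → RankingOf t S u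

left-sound : ∀ {l r} (d : Dec (l ≅ r)) S → Sorted S → ∀ {p x} →
  p ∈ splitsFor d S (internals l) (internals r) → x ∈ rankings l (proj₁ p) → RankingOf l (proj₁ p) x
left-sound {l} d S sS p∈ x∈ = rankings-sound l _ (proj₁ (parts-sorted d S sS p∈)) x∈

right-sound : ∀ {l r} (d : Dec (l ≅ r)) S → Sorted S → ∀ {p y} →
  p ∈ splitsFor d S (internals l) (internals r) → y ∈ rankings r (proj₂ p) → RankingOf r (proj₂ p) y
right-sound {r = r} d S sS p∈ y∈ = rankings-sound r _ (proj₂ (parts-sorted d S sS p∈)) y∈

rankings-sound leaf []                  _          (here refl) = record { shape = refl ; rankList = ↭-refl ; increasing = incLeaf }
rankings-sound (node l r) (k ∷ S) (k<S ∷ sS) u∈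
  with graft⁻ k (rankings l) (rankings r) (splitsFor (l ≅? r) S (internals l) (internals r)) u∈
... | grafted {p} {x} {y} p∈ x∈ y∈ = record
  { shape      = cong₂ node (shape x-ok) (shape y-ok)
  ; rankList   = prep k (↭-trans (++⁺ (rankList x-ok) (rankList y-ok)) (splits-↭ S p∈′))
  ; increasing = incNode (above x-ok (splits-⊆ˡ S p∈′)) (above y-ok (splits-⊆ʳ S p∈′)) (increasing x-ok) (increasing y-ok)
  }
  where
  p∈′ : p ∈ splits S (internals l) (internals r)
  p∈′ = splitsFor-⊆ (l ≅? r) S (internals l) (internals r) p∈
  x-ok : RankingOf l (proj₁ p) x
  x-ok = left-sound (l ≅? r) S sS p∈ x∈
  y-ok : RankingOf r (proj₂ p) y
  y-ok = right-sound (l ≅? r) S sS p∈ y∈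
  above : ∀ {t′ A′ v} → RankingOf t′ A′ v → A′ ⊆ S → All (k <_) (ranks v)
  above v-ok A′⊆S = All-resp-↭ (↭-sym (rankList v-ok)) (All-resp-⊇ A′⊆S k<S)

rankings-complete : ∀ t S → Sorted S → ∀ u → ranks u ↭ S → Increasing u → forget u ≅ t →
  Σ[ v ∈ RTree ] v ∈ rankings t S × u ≅ʳ v

complete-node : ∀ {l r} (d : Dec (l ≅ r)) k S → Sorted S → ∀ x y →
  ranks x ++ ranks y ↭ S → Increasing x → Increasing y → forget x ≅ l → forget y ≅ r →
  Σ[ v ∈ RTree ] v ∈ graft k (rankings l) (rankings r) (splitsFor d S (internals l) (internals r)) × rnode k x y ≅ʳ v

rankings-complete leaf S _ rleaf u↭S _ leaf≅ with ↭-empty-inv (↭-sym u↭S)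
... | refl = rleaf , here refl , leaf≅ʳ
rankings-complete (node l r) [] _ (rnode k x y) u↭[] _ _ with ↭-empty-inv u↭[]
... | ()
rankings-complete (node l r) (s ∷ S) (s<S ∷ sS) (rnode k x y) u↭ (incNode k<x k<y incx incy) u≅t
  with root-least (All.++⁺ k<x k<y) s<S u↭
... | refl with u≅t
...   | same≅ x≅l y≅r = complete-node (l ≅? r) k S sS x y (drop-∷ u↭) incx incy x≅l y≅r
...   | cross≅ x≅r y≅l =
  let v , v∈ , yx≅v = complete-node (l ≅? r) k S sS y x (↭-trans (++-comm (ranks y) (ranks x)) (drop-∷ u↭))
                                    incy incx y≅l x≅r
  in v , v∈ , ≅ʳ-trans (cross≅ʳ (≅ʳ-refl x) (≅ʳ-refl y)) yx≅v

complete-node {l} {r} d k S sS x y xy↭S incx incy x≅l y≅r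
  with splits-complete S (ranks x) (ranks y) xy↭S
... | (A , B) , p∈ , x↭A , y↭B = place d
  where
  p∈′ : (A , B) ∈ splits S (internals l) (internals r)
  p∈′ = subst₂ (λ a b → (A , B) ∈ splits S a b)
          (trans (length-ranks x) (internals-≅ x≅l)) (trans (length-ranks y) (internals-≅ y≅r)) p∈
  sA : Sorted A
  sA = proj₁ (splits-sorted S sS p∈′)
  sB : Sorted B
  sB = proj₂ (splits-sorted S sS p∈′)
  straight : ∀ {sp} → (A , B) ∈ sp → Σ[ v ∈ RTree ] v ∈ graft k (rankings l) (rankings r) sp × rnode k x y ≅ʳ v
  straight {sp} p∈sp =
    let x′ , x′∈ , x≅x′ = rankings-complete l A sA x x↭A incx x≅l
        y′ , y′∈ , y≅y′ = rankings-complete r B sB y y↭B incy y≅r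
    in rnode k x′ y′ , graft⁺ k (rankings l) (rankings r) sp p∈sp x′∈ y′∈ , same≅ʳ x≅x′ y≅y′
  exchanged : l ≅ r → ∀ {sp} → (B , A) ∈ sp → Σ[ v ∈ RTree ] v ∈ graft k (rankings l) (rankings r) sp × rnode k x y ≅ʳ v
  exchanged l≅r {sp} q∈sp =
    let y′ , y′∈ , y≅y′ = rankings-complete l B sB y y↭B incy (≅-trans y≅r (≅-sym l≅r))
        x′ , x′∈ , x≅x′ = rankings-complete r A sA x x↭A incx (≅-trans x≅l l≅r)
    in rnode k y′ x′ , graft⁺ k (rankings l) (rankings r) sp q∈sp y′∈ x′∈ , cross≅ʳ x≅x′ y≅y′
  place : (d : Dec (l ≅ r)) →
    Σ[ v ∈ RTree ] v ∈ graft k (rankings l) (rankings r) (splitsFor d S (internals l) (internals r)) × rnode k x y ≅ʳ v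
  place (no _)    = straight p∈′
  place (yes l≅r) with leftFirst-cover S (internals l) (internals r) p∈′
  ... | inj₁ p∈L    = straight p∈L
  ... | inj₂ swap∈L = exchanged l≅r (subst₂ (λ a b → (B , A) ∈ leftFirst S a b) (sym l≡r) l≡r swap∈L)
    where
    l≡r : internals l ≡ internals r
    l≡r = internals-≅ l≅r

ranks-⊆ : ∀ {t t′ A A′ x x′} → RankingOf t A x → RankingOf t′ A′ x′ → x ≅ʳ x′ → A ⊆ A′
ranks-⊆ x-ok x′-ok x≅x′ =
  ⊆-reflexive-↭ (↭-trans (↭-sym (rankList x-ok)) (↭-trans (ranks-≅ʳ x≅x′) (rankList x′-ok)))

split-determined : ∀ {l r} (d : Dec (l ≅ r)) S → Sorted S → ∀ {p q x x′ y y′} →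
  p ∈ splitsFor d S (internals l) (internals r) → q ∈ splitsFor d S (internals l) (internals r) →
  x ∈ rankings l (proj₁ p) → x′ ∈ rankings l (proj₁ q) → y ∈ rankings r (proj₂ p) → y′ ∈ rankings r (proj₂ q) →
  x ≅ʳ x′ → y ≅ʳ y′ → p ≡ q
split-determined {l} {r} d S sS p∈ q∈ x∈ x′∈ y∈ y′∈ x≅x′ y≅y′ =
  splits-determined S sS (splitsFor-⊆ d S (internals l) (internals r) p∈) (splitsFor-⊆ d S (internals l) (internals r) q∈)
    (ranks-⊆ (left-sound d S sS p∈ x∈) (left-sound d S sS q∈ x′∈) x≅x′)
    (ranks-⊆ (right-sound d S sS p∈ y∈) (right-sound d S sS q∈ y′∈) y≅y′)

-- An isomorphism between two nodes of rankings t S cannot exchange their children: without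
-- symmetry the shapes differ, and with symmetry the least remaining rank lies on the left in both
-- nodes; only at a cherry, where both nodes coincide, is the exchange possible.
no-exchange : ∀ {l r} (d : Dec (l ≅ r)) k S → Sorted S → ∀ {p q x x′ y y′} →
  p ∈ splitsFor d S (internals l) (internals r) → q ∈ splitsFor d S (internals l) (internals r) →
  x ∈ rankings l (proj₁ p) → x′ ∈ rankings l (proj₁ q) → y ∈ rankings r (proj₂ p) → y′ ∈ rankings r (proj₂ q) →
  x ≅ʳ y′ → rnode k x y ≡ rnode k x′ y′
no-exchange (no l≇r) k S sS p∈ q∈ x∈ _ _ y′∈ x≅y′ =
  ⊥-elim (l≇r (subst₂ _≅_ (shape (left-sound (no l≇r) S sS p∈ x∈)) (shape (right-sound (no l≇r) S sS q∈ y′∈))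
                          (forget-≅ʳ x≅y′)))
no-exchange {l} {r} (yes _) k [] _ p∈ q∈ x∈ x′∈ y∈ y′∈ _
  with splits-[] (internals l) (internals r) p∈ | splits-[] (internals l) (internals r) q∈
... | refl | refl = cong₂ (rnode k) (trans (rankings-[] l x∈) (sym (rankings-[] l x′∈)))
                                    (trans (rankings-[] r y∈) (sym (rankings-[] r y′∈)))
no-exchange {l} {r} (yes l≅r) k (h ∷ T) sS {q = q} {x} p∈ q∈ x∈ _ _ y′∈ x≅y′ =
  ⊥-elim (splits-disjoint (h ∷ T) {internals l} {internals r} sS (leftFirst-⊆ (h ∷ T) (internals l) (internals r) q∈) (h∈A′ , h∈B′))
  where
  h∈x : h ∈ ranks x
  h∈x = ∈-resp-↭ (↭-sym (rankList (left-sound (yes l≅r) (h ∷ T) sS p∈ x∈)))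
                  (headLeft-head h T (internals l) (internals r) p∈)
  h∈B′ : h ∈ proj₂ q
  h∈B′ = ∈-resp-↭ (rankList (right-sound (yes l≅r) (h ∷ T) sS q∈ y′∈)) (∈-resp-↭ (ranks-≅ʳ x≅y′) h∈x)
  h∈A′ : h ∈ proj₁ q
  h∈A′ = headLeft-head h T (internals l) (internals r) q∈

rankings-rigid : ∀ t S → Sorted S → ∀ {u v} → u ∈ rankings t S → v ∈ rankings t S → u ≅ʳ v → u ≡ v
rigid-node : ∀ {l r} (d : Dec (l ≅ r)) k S → Sorted S → ∀ {u v} →
  u ∈ graft k (rankings l) (rankings r) (splitsFor d S (internals l) (internals r)) →
  v ∈ graft k (rankings l) (rankings r) (splitsFor d S (internals l) (internals r)) → u ≅ʳ v → u ≡ v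

rankings-rigid leaf       []      _        (here refl) (here refl) _ = refl
rankings-rigid (node l r) (k ∷ S) (_ ∷ sS) = rigid-node (l ≅? r) k S sS

rigid-node {l} {r} d k S sS u∈ v∈ u≅v
  with graft⁻ k (rankings l) (rankings r) (splitsFor d S (internals l) (internals r)) u∈
     | graft⁻ k (rankings l) (rankings r) (splitsFor d S (internals l) (internals r)) v∈
... | grafted {p} p∈ x∈ y∈ | grafted q∈ x′∈ y′∈ with u≅v
...   | cross≅ʳ x≅y′ _ = no-exchange d k S sS p∈ q∈ x∈ x′∈ y∈ y′∈ x≅y′
...   | same≅ʳ x≅x′ y≅y′ with split-determined d S sS p∈ q∈ x∈ x′∈ y∈ y′∈ x≅x′ y≅y′
...     | refl = cong₂ (rnode k) (rankings-rigid l _ sA x∈ x′∈ x≅x′) (rankings-rigid r _ sB y∈ y′∈ y≅y′)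
  where
  sA : Sorted (proj₁ p)
  sA = proj₁ (parts-sorted d S sS p∈)
  sB : Sorted (proj₂ p)
  sB = proj₂ (parts-sorted d S sS p∈)

rankings-unique : ∀ t S → Sorted S → Unique (rankings t S)
rankings-unique leaf       []      _ = [] ∷ []
rankings-unique leaf       (_ ∷ _) _ = []
rankings-unique (node l r) []      _ = []
rankings-unique (node l r) (k ∷ S) (_ ∷ sS) =
  graft-unique k (rankings l) (rankings r) _ (splitsFor-unique (l ≅? r) S (internals l) (internals r) sS)
    (λ p∈ → let sA , sB = parts-sorted (l ≅? r) S sS p∈ in rankings-unique l _ sA , rankings-unique r _ sB)
    (λ p∈ q∈ x∈ x∈′ y∈ y∈′ → split-determined (l ≅? r) S sS p∈ q∈ x∈ x∈′ y∈ y∈′ (≅ʳ-refl _) (≅ʳ-refl _))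

rankings-distinct : ∀ t S → Sorted S → AllPairs (λ u v → ¬ u ≅ʳ v) (rankings t S)
rankings-distinct t S sS =
  AllPairs-mapWith∈ (λ u∈ v∈ u≢v u≅v → u≢v (rankings-rigid t S sS u∈ v∈ u≅v)) (rankings-unique t S sS)

rankingCount : Tree → ℕ
rankingCount leaf       = 1
rankingCount (node l r) = splitCount (l ≅? r) (internals l) (internals r) * (rankingCount l * rankingCount r)

length-rankings : ∀ t S → length S ≡ internals t → length (rankings t S) ≡ rankingCount t
length-rankings leaf       []      _ = refl
length-rankings (node l r) (k ∷ S) e =
  trans (length-graft k (rankings l) (rankings r) sp (All.tabulate children))
        (cong (_* (rankingCount l * rankingCount r))
              (length-splitsFor (l ≅? r) S (internals l) (internals r) (suc-injective e)))
  where
  sp : List Split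
  sp = splitsFor (l ≅? r) S (internals l) (internals r)
  children : ∀ {p} → p ∈ sp →
    length (rankings l (proj₁ p)) ≡ rankingCount l × length (rankings r (proj₂ p)) ≡ rankingCount r
  children p∈ = let eA , eB = splits-length S (splitsFor-⊆ (l ≅? r) S (internals l) (internals r) p∈)
                in length-rankings l _ eA , length-rankings r _ eB

splitCount-symmetric : ∀ {l r} (d : Dec (l ≅ r)) → l ≅ r → ∀ a b → splitCount d a b ≡ leftFirstCount a b
splitCount-symmetric (yes _)  _   a b = refl
splitCount-symmetric (no l≇r) l≅r a b = ⊥-elim (l≇r l≅r)

splitCount-asymmetric : ∀ {l r} (d : Dec (l ≅ r)) → ¬ l ≅ r → ∀ a b → splitCount d a b ≡ shuffles a b
splitCount-asymmetric (yes l≅r) l≇r a b = ⊥-elim (l≇r l≅r)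
splitCount-asymmetric (no _)    _   a b = refl

Formula : Tree → ℕ → Set
Formula t s = rankingCount t * subtreeProd t * 2 ^ s ≡ internals t ! * 2 ^ cherries t

-- One node of the recurrence with c = (a + b choose a) admissible splits, given the formula
-- for both children:  (a + b choose a) * a! * b! * (a + b + 1) = (a + b + 1)!.
node-step : ∀ l r i j {c} → c ≡ shuffles (internals l) (internals r) → Formula l i → Formula r j →
  c * (rankingCount l * rankingCount r) * subtreeProd (node l r) * 2 ^ (i + j)
    ≡ internals (node l r) ! * 2 ^ (cherries l + cherries r)
node-step l r i j refl IHl IHr = begin
    shuffles a b * (Nl * Nr) * (suc (a + b) * (Pl * Pr)) * 2 ^ (i + j)
  ≡⟨ cong (shuffles a b * (Nl * Nr) * (suc (a + b) * (Pl * Pr)) *_) (^-distribˡ-+-* 2 i j) ⟩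
    shuffles a b * (Nl * Nr) * (suc (a + b) * (Pl * Pr)) * (2 ^ i * 2 ^ j)
  ≡⟨ regroup (shuffles a b) Nl Nr (a + b) Pl Pr (2 ^ i) (2 ^ j) ⟩
    suc (a + b) * shuffles a b * (Nl * Pl * 2 ^ i) * (Nr * Pr * 2 ^ j)
  ≡⟨ cong₂ (λ u v → suc (a + b) * shuffles a b * u * v) IHl IHr ⟩
    suc (a + b) * shuffles a b * (a ! * 2 ^ cl) * (b ! * 2 ^ cr)
  ≡⟨ regroup′ (suc (a + b)) (shuffles a b) (a !) (b !) (2 ^ cl) (2 ^ cr) ⟩
    suc (a + b) * (shuffles a b * (a ! * b !)) * (2 ^ cl * 2 ^ cr)
  ≡⟨ cong₂ (λ u v → suc (a + b) * u * v) (shuffles-factorial a b) (sym (^-distribˡ-+-* 2 cl cr)) ⟩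
    suc (a + b) ! * 2 ^ (cl + cr)
  ∎
  where
  open ≡-Reasoning
  a b Nl Nr Pl Pr cl cr : ℕ
  a = internals l
  b = internals r
  Nl = rankingCount l
  Nr = rankingCount r
  Pl = subtreeProd l
  Pr = subtreeProd r
  cl = cherries l
  cr = cherries r
  regroup : ∀ c nl nr m pl pr x y →
    c * (nl * nr) * (suc m * (pl * pr)) * (x * y) ≡ suc m * c * (nl * pl * x) * (nr * pr * y)
  regroup = solve-∀
  regroup′ : ∀ m c fa fb x y → m * c * (fa * x) * (fb * y) ≡ m * (c * (fa * fb)) * (x * y)
  regroup′ = solve-∀

-- exchanging the parts pairs up the splits of a list with least element on the left
halving : ∀ a b → suc a ≡ b → 2 * shuffles a b ≡ shuffles (suc a) b
halving a .(suc a) refl = sym (shuffles-diagonal a)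

-- A non-cherry symmetry node: half of the shuffles are left-first, and 2 ^ s gains a factor 2.
symmetric-step : ∀ l₁ l₂ r i j → node l₁ l₂ ≅ r → Formula (node l₁ l₂) i → Formula r j →
  Formula (node (node l₁ l₂) r) (suc (i + j))
symmetric-step l₁ l₂ r i j l≅r IHl IHr = begin
    splitCount (l ≅? r) (suc a) b * N * P * 2 ^ suc (i + j)
  ≡⟨ cong (λ c → c * N * P * 2 ^ suc (i + j)) (splitCount-symmetric (l ≅? r) l≅r (suc a) b) ⟩
    shuffles a b * N * P * (2 * 2 ^ (i + j))
  ≡⟨ move-two (shuffles a b) N P (2 ^ (i + j)) ⟩
    2 * shuffles a b * N * P * 2 ^ (i + j)
  ≡⟨ node-step l r i j (halving a b (internals-≅ l≅r)) IHl IHr ⟩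
    internals (node l r) ! * 2 ^ (cherries l + cherries r)
  ∎
  where
  open ≡-Reasoning
  l : Tree
  l = node l₁ l₂
  a b N P : ℕ
  a = internals l₁ + internals l₂
  b = internals r
  N = rankingCount l * rankingCount r
  P = subtreeProd (node l r)
  move-two : ∀ c n p x → c * n * p * (2 * x) ≡ 2 * c * n * p * x
  move-two = solve-∀

rankingCount-formula : ∀ {t s} → SymCount t s → Formula t s
rankingCount-formula symLeaf = refl
rankingCount-formula (symYes {leaf}       {leaf} _ symLeaf symLeaf) = refl
rankingCount-formula (symYes {node l₁ l₂} {r} {i} {j} l≅r sl sr) =
  symmetric-step l₁ l₂ r i j l≅r (rankingCount-formula sl) (rankingCount-formula sr)
rankingCount-formula (symNo {l} {r} {i} {j} l≇r sl sr) =
  trans (node-step l r i j (splitCount-asymmetric (l ≅? r) l≇r _ _) (rankingCount-formula sl) (rankingCount-formula sr))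
        (cong (λ c → internals (node l r) ! * 2 ^ c) (sym (cherries-node l r l≇r)))

ranks-sorted : ∀ m → Sorted (map suc (upTo m))
ranks-sorted m = AllPairs.map⁺ (AllPairs.applyUpTo⁺₁ (λ i → i) m (λ i<j _ → s≤s i<j))

mainTheorem4 : (n : ℕ) → 2 ≤ n → (t : Tree) → leaves t ≡ n →
    (s : ℕ) → SymCount t s →
    Σ (List RTree) (λ L →
      All (λ r → IsRanking n r × forget r ≅ t) L
      × AllPairs (λ a b → ¬ (a ≅ʳ b)) L
      × (∀ r → IsRanking n r → forget r ≅ t → Any (r ≅ʳ_) L)
      × length L * subtreeProd t * 2 ^ s ≡ (n ∸ 1) ! * 2 ^ cherries t)
mainTheorem4 n _ t leaves≡n s symmetries =
  rankings t S
  , All.tabulate ranked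
  , rankings-distinct t S S-sorted
  , (λ u (_ , u↭S , u-increasing) u≅t →
       let v , v∈ , u≅v = rankings-complete t S S-sorted u u↭S u-increasing u≅t in lose v∈ u≅v)
  , count
  where
  open ≡-Reasoning
  S : List ℕ
  S = map suc (upTo (n ∸ 1))
  S-sorted : Sorted S
  S-sorted = ranks-sorted (n ∸ 1)
  n-1≡internals : n ∸ 1 ≡ internals t
  n-1≡internals = cong (_∸ 1) (trans (sym leaves≡n) (leaves-internals t))
  ranked : ∀ {u} → u ∈ rankings t S → IsRanking n u × forget u ≅ t
  ranked u∈ = let u-ok = rankings-sound t S S-sorted u∈ in
    (trans (cong leaves (shape u-ok)) leaves≡n , rankList u-ok , increasing u-ok) , subst (_≅ t) (sym (shape u-ok)) (≅-refl t)
  count : length (rankings t S) * subtreeProd t * 2 ^ s ≡ (n ∸ 1) ! * 2 ^ cherries t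
  count = begin
      length (rankings t S) * subtreeProd t * 2 ^ s
    ≡⟨ cong (λ c → c * subtreeProd t * 2 ^ s)
            (length-rankings t S (trans (length-map suc (upTo (n ∸ 1))) (trans (length-upTo (n ∸ 1)) n-1≡internals))) ⟩
      rankingCount t * subtreeProd t * 2 ^ s
    ≡⟨ rankingCount-formula symmetries ⟩
      internals t ! * 2 ^ cherries t
    ≡⟨ cong (λ m → m ! * 2 ^ cherries t) (sym n-1≡internals) ⟩
      (n ∸ 1) ! * 2 ^ cherries t
    ∎
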